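{- Let $p$ be an odd prime and let $a,b$ be integers with $1\le a,b\le\lfloor\sqrt p\rfloor$ and $a>b$. Then there do not exist integers $c,d$ with $1\le c,d\le\lfloor\sqrt p\rfloor$ such that $$1-\frac{a}{b}\equiv\frac{c}{d} \pmod p,$$ where the fractions denote $ab^{ -1}$ and $cd^{ -1}$ in $\mathbb{F}_p$. -}

module Defs where

open import Data.Integer using (ℤ; _-_; _*_; +_)
open import Data.Integer.Divisibility using (_∣_)
open import Data.Nat using (ℕ; _≤_)
import Data.Nat as ℕ
open import Data.Product using (_×_)

_≡_[mod_] : ℤ → ℤ → ℕ → Set
x ≡ y [mod p ] = + p ∣ (x - y)

-- x represents the fraction u/v = u·v⁻¹ in 𝔽_p : v · x ≡ u (mod p).
-- (For v a unit mod p this determines x uniquely mod p.)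
IsFrac : ℕ → ℤ → ℤ → ℤ → Set
IsFrac p x u v = (v * x) ≡ u [mod p ]

-- 1 ≤ n ≤ ⌊√p⌋, using n ≤ ⌊√p⌋ ⟺ n² ≤ p for natural n.
InRange : ℕ → ℕ → Set
InRange p n = (1 ≤ n) × (n ℕ.* n ≤ p)

{-# OPTIONS --safe #-}
-- Clearing denominators, 1 - a/b ≡ c/d turns into p ∣ (a - b)·d + b·c. This
-- number is positive and at most a·max(c, d), a product of two numbers in
-- [1, ⌊√p⌋], which is < p because p is prime and hence not such a product.
module Submission where

open import Defs
open import Data.Nat using (ℕ; _>_)
open import Data.Nat.Primality using (Prime)
open import Data.Integer using (ℤ; +_; _-_)
open import Data.Product using (_×_; ∃-syntax)
open import Relation.Nullary using (¬_)

open import Data.Nat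
  using (_+_; _*_; _∸_; _⊔_; _≤_; _<_; >-nonZero; nonTrivial⇒n>1)
open import Data.Nat.Properties
open import Data.Nat.Divisibility using (_∣_; ∣-refl; ∣⇒≤; >⇒∤)
open import Data.Nat.Primality using (euclidsLemma; prime⇒nonZero; prime⇒nonTrivial)
import Data.Integer as ℤ
import Data.Integer.Properties as ℤ
import Data.Integer.Divisibility as ℤ
import Data.Integer.Divisibility.Signed as Signed
open import Data.Integer.Tactic.RingSolver using (solve-∀)
open import Data.Product using (_,_)
open import Data.Sum using (inj₁; inj₂)
open import Relation.Binary.PropositionalEquality
  using (_≡_; _≢_; refl; sym; trans; cong; cong₂; subst; module ≡-Reasoning)

one-minus-frac≡frac⇒∣ : ∀ {p} x y u v w t →
  IsFrac p x u v → IsFrac p y w t → (+ 1 - x) ≡ y [mod p ] →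
  + p ℤ.∣ (u - v) ℤ.* t ℤ.+ v ℤ.* w
one-minus-frac≡frac⇒∣ {p} x y u v w t vx≡u ty≡w 1-x≡y =
  Signed.∣⇒∣ᵤ (subst (Signed._∣_ (+ p)) (identity u v w t x y)
    (Signed.∣m⇒∣-m
      (Signed.∣m∣n⇒∣m+n
        (Signed.∣m∣n⇒∣m+n (Signed.∣n⇒∣m*n t (Signed.∣ᵤ⇒∣ vx≡u))
                          (Signed.∣n⇒∣m*n v (Signed.∣ᵤ⇒∣ ty≡w)))
        (Signed.∣n⇒∣m*n (v ℤ.* t) (Signed.∣ᵤ⇒∣ 1-x≡y)))))
  where
  identity : ∀ u v w t x y →
    ℤ.- (t ℤ.* (v ℤ.* x - u) ℤ.+ v ℤ.* (t ℤ.* y - w) ℤ.+ v ℤ.* t ℤ.* ((+ 1 - x) - y))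
    ≡ (u - v) ℤ.* t ℤ.+ v ℤ.* w
  identity = solve-∀

pos-∸*+* : ∀ {a b} c d → b ≤ a →
  + ((a ∸ b) * d + b * c) ≡ (+ a - + b) ℤ.* + d ℤ.+ + b ℤ.* + c
pos-∸*+* {a} {b} c d b≤a = begin
  + ((a ∸ b) * d + b * c)            ≡⟨ ℤ.pos-+ ((a ∸ b) * d) (b * c) ⟩
  + ((a ∸ b) * d) ℤ.+ + (b * c)      ≡⟨ cong₂ ℤ._+_ (ℤ.pos-* (a ∸ b) d) (ℤ.pos-* b c) ⟩
  + (a ∸ b) ℤ.* + d ℤ.+ + b ℤ.* + c  ≡⟨ cong (λ z → z ℤ.* + d ℤ.+ + b ℤ.* + c) +[a∸b]≡a-b ⟩
  (+ a - + b) ℤ.* + d ℤ.+ + b ℤ.* + c ∎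
  where
  open ≡-Reasoning
  +[a∸b]≡a-b : + (a ∸ b) ≡ + a - + b
  +[a∸b]≡a-b = sym (trans (ℤ.m-n≡m⊖n a b) (ℤ.⊖-≥ b≤a))

*≤-if-squares≤ : ∀ {n} x y → x * x ≤ n → y * y ≤ n → x * y ≤ n
*≤-if-squares≤ x y x²≤n y²≤n with ≤-total x y
... | inj₁ x≤y = ≤-trans (*-monoˡ-≤ y x≤y) y²≤n
... | inj₂ y≤x = ≤-trans (*-monoʳ-≤ x y≤x) x²≤n

*+*≤+*⊔ : ∀ s t c d → s * d + t * c ≤ (s + t) * (c ⊔ d)
*+*≤+*⊔ s t c d = begin
  s * d + t * c             ≤⟨ +-mono-≤ (*-monoʳ-≤ s (m≤n⊔m c d)) (*-monoʳ-≤ t (m≤m⊔n c d)) ⟩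
  s * (c ⊔ d) + t * (c ⊔ d) ≡⟨ *-distribʳ-+ (c ⊔ d) s t ⟨
  (s + t) * (c ⊔ d)         ∎
  where open ≤-Reasoning

InRange-⊔ : ∀ {p c d} → InRange p c → InRange p d → InRange p (c ⊔ d)
InRange-⊔ {p} {c} {d} c∈ d∈ with ⊔-sel c d
... | inj₁ c⊔d≡c = subst (InRange p) (sym c⊔d≡c) c∈
... | inj₂ c⊔d≡d = subst (InRange p) (sym c⊔d≡d) d∈

InRange⇒prime∤ : ∀ {p x} → Prime p → InRange p x → ¬ p ∣ x
InRange⇒prime∤ {p} {x} p-prime (1≤x , x²≤p) p∣x = <-irrefl refl (begin-strict
  p     <⟨ m<m*n p p (nonTrivial⇒n>1 p) ⟩
  p * p ≤⟨ *-mono-≤ (∣⇒≤ p∣x) (∣⇒≤ p∣x) ⟩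
  x * x ≤⟨ x²≤p ⟩
  p     ∎)
  where
  open ≤-Reasoning
  instance
    _ = prime⇒nonZero p-prime
    _ = prime⇒nonTrivial p-prime
    _ = >-nonZero 1≤x

InRange⇒*<prime : ∀ {p x y} → Prime p → InRange p x → InRange p y → x * y < p
InRange⇒*<prime {p} {x} {y} p-prime x∈@(_ , x²≤p) y∈@(_ , y²≤p) =
  ≤∧≢⇒< (*≤-if-squares≤ x y x²≤p y²≤p) xy≢p
  where
  xy≢p : x * y ≢ p
  xy≢p xy≡p with euclidsLemma x y p-prime (subst (p ∣_) (sym xy≡p) ∣-refl)
  ... | inj₁ p∣x = InRange⇒prime∤ p-prime x∈ p∣x
  ... | inj₂ p∣y = InRange⇒prime∤ p-prime y∈ p∣y

lemma1 : (p : ℕ) → Prime p → p > 2 →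
    (a b : ℕ) → InRange p a → InRange p b → a > b →
    ¬ (∃[ c ] ∃[ d ] ∃[ x ] ∃[ y ]
         (InRange p c × InRange p d ×
          IsFrac p x (+ a) (+ b) × IsFrac p y (+ c) (+ d) ×
          ((+ 1 - x) ≡ y [mod p ])))
lemma1 p p-prime _ a b a∈ (1≤b , _) b<a
       (c , d , x , y , c∈@(1≤c , _) , d∈ , bx≡a , dy≡c , 1-x≡y) = >⇒∤ N<p p∣N
  where
  N : ℕ
  N = (a ∸ b) * d + b * c

  0<N : 0 < N
  0<N = ≤-trans (*-mono-≤ 1≤b 1≤c) (m≤n+m (b * c) ((a ∸ b) * d))

  instance _ = >-nonZero 0<N

  p∣N : p ∣ N
  p∣N = subst (ℤ._∣_ (+ p)) (sym (pos-∸*+* c d (<⇒≤ b<a)))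
          (one-minus-frac≡frac⇒∣ x y (+ a) (+ b) (+ c) (+ d) bx≡a dy≡c 1-x≡y)

  N<p : N < p
  N<p = begin-strict
    (a ∸ b) * d + b * c    ≤⟨ *+*≤+*⊔ (a ∸ b) b c d ⟩
    (a ∸ b + b) * (c ⊔ d)  ≡⟨ cong (_* (c ⊔ d)) (m∸n+n≡m (<⇒≤ b<a)) ⟩
    a * (c ⊔ d)            <⟨ InRange⇒*<prime p-prime a∈ (InRange-⊔ c∈ d∈) ⟩
    p                      ∎
    where open ≤-Reasoning
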